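{- Let $N>2$ and let $G$ be an $N$-player partizan game with $G=0$. Then $G\cong 0$.
   Context: An $N$-player partizan game is an ordered $N$-tuple $(\mathscr G^{C_0},\dots,\mathscr G^{C_{N-1}})$ of finite sets of partizan games (no infinite runs); players Left $=C_0$, $C_1,\dots,C_{N-2}$, Right $=C_{N-1}$ move cyclically, $\mathscr G^{C_i}$ being the options for $C_i$. Under normal play, a player with no option on their turn is the unique loser and all others win. $0$ is the game with no options and $\cong$ is isomorphism of game trees. The disjunctive sum $G+H$ has $C_i$-options $G^{C_i}+H$ and $G+H^{C_i}$. Equality $G=H$ means: for every game $X$ and every choice of player to move first, the set of players having a strategy guaranteeing they do not lose in $G+X$ equals that set in $H+X$ (i.e. $o(G+X)=o(H+X)$ for all $X$, where $o$ records, for each possible first player, which players can guarantee not losing). -}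

module Defs where

open import Data.Nat using (ℕ; zero; suc; _+_; _<_)
open import Data.Nat.DivMod using (_%_; m%n<n)
open import Data.Fin using (Fin; toℕ; fromℕ<; splitAt; _≟_)
open import Data.Sum using ([_,_])
open import Data.Product using (_×_; ∃)
open import Relation.Nullary using (yes; no)
open import Function.Bundles using (_⇔_)

-- An N-player partizan game: for each player i : Fin N (player 0 = Left,
-- player N-1 = Right) a finite family of options, indexed by Fin (count i).
data Game (N : ℕ) : Set where
  mk : (count : Fin N → ℕ) → ((i : Fin N) → Fin (count i) → Game N) → Game N

module _ {N : ℕ} where

  zeroG : Game N
  zeroG = mk (λ _ → 0) (λ _ ())

  _⊕_ : Game N → Game N → Game N
  mk n o ⊕ mk m p =
    mk (λ i → n i + m i)
       (λ i j → [ (λ a → o i a ⊕ mk m p) , (λ b → mk n o ⊕ p i b) ] (splitAt (n i) j))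

  -- isomorphism of game trees (option collections read as sets)
  _≅_ : Game N → Game N → Set
  mk n o ≅ mk m p = ∀ i →
    (∀ a → ∃ λ b → o i a ≅ p i b) × (∀ b → ∃ λ a → o i a ≅ p i b)

  next : Fin N → Fin N
  next {- N = suc k -} i = help N i
    where
      help : (M : ℕ) → Fin M → Fin M
      help (suc k) j = fromℕ< (m%n<n (suc (toℕ j)) (suc k))

  -- CanAvoid p G t : player p has a strategy guaranteeing they do not lose
  -- in G when player t is to move.  Under normal play the player to move
  -- with no option is the unique loser.
  CanAvoid : Fin N → Game N → Fin N → Set
  CanAvoid p (mk n o) t with p ≟ t
  ... | yes _ = ∃ λ (j : Fin (n t)) → CanAvoid p (o t j) (next t)
  ... | no  _ = (j : Fin (n t)) → CanAvoid p (o t j) (next t)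

  _≈G_ : Game N → Game N → Set
  G ≈G H = (X : Game N) (first p : Fin N) →
    CanAvoid p (G ⊕ X) first ⇔ CanAvoid p (H ⊕ X) first

module Submission where

-- Suppose G has an option for some player i, and let p = next i and
-- q = next p; with N > 2 the players i, p, q are distinct.  We build a
-- context X in which every player except i and p has a single move into a
-- long "stall": a game in which everyone except p may pass, M times.
--   * In 0 + X with i to move, i has no move at all, so p survives.
--   * In G + X with i to move, i moves in G; then p must move in G (X offers
--     p nothing), q moves into the stall, and from then on the opponents of
--     p simply pass while p is forced to use up the finitely many moves left
--     in G.  Taking M larger than N times the height of G, p runs out first.
-- So o(G + X) ≠ o(0 + X), contradicting G = 0; hence G has no options.

open import Defs
open import Data.Nat using (ℕ; zero; suc; _+_; _*_; _≤_; _<_; _⊔_; NonZero; z≤n; s≤s)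
open import Data.Nat.Properties hiding (_≟_)
open import Data.Nat.DivMod using (_%_; _/_; m%n<n; %-distribˡ-+; m%n%n≡m%n; [m+n]%n≡m%n; m<n⇒m%n≡m; m≡m%n+[m/n]*n)
open import Data.Bool using (Bool; true; false; if_then_else_; not; _∧_)
open import Data.Bool.Properties using (∧-zeroʳ)
open import Data.Fin as Fin using (Fin; toℕ; splitAt; _↑ˡ_; _↑ʳ_; _≟_)
open import Data.Fin.Properties using (toℕ-fromℕ<; toℕ-injective; toℕ<n; splitAt-↑ˡ; splitAt-↑ʳ; ¬Fin0)
open import Data.Sum using (_⊎_; inj₁; inj₂; [_,_])
open import Data.Product using (_,_; ∃)
open import Data.Empty using (⊥-elim)
open import Relation.Nullary using (¬_; does; yes; no)
open import Relation.Nullary.Decidable using (dec-true; dec-false)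
open import Relation.Binary.PropositionalEquality hiding ([_])
open import Function.Bundles using (Equivalence)

[m%d+n]%d≡[m+n]%d : ∀ m n d .{{_ : NonZero d}} → (m % d + n) % d ≡ (m + n) % d
[m%d+n]%d≡[m+n]%d m n d = begin
  (m % d + n) % d           ≡⟨ %-distribˡ-+ (m % d) n d ⟩
  (m % d % d + n % d) % d   ≡⟨ cong (λ v → (v + n % d) % d) (m%n%n≡m%n m d) ⟩
  (m % d + n % d) % d       ≡⟨ %-distribˡ-+ m n d ⟨
  (m + n) % d               ∎
  where open ≡-Reasoning

positive-multiple≥ : ∀ c d → 0 < c * d → d ≤ c * d
positive-multiple≥ (suc c) d _ = m≤m+n d (c * d)

blocks-room : ∀ {a b r d} → a < b → r < d → a * d + r ≤ b * d
blocks-room {a} {b} {r} {d} a<b r<d = begin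
  a * d + r   ≤⟨ <⇒≤ (+-monoʳ-< (a * d) r<d) ⟩
  a * d + d   ≡⟨ +-comm (a * d) d ⟩
  suc a * d   ≤⟨ *-monoˡ-≤ d a<b ⟩
  b * d       ∎
  where open ≤-Reasoning

-- The options of G ⊕ H for t are indexed by splitAt (count G t): moves in G
-- come first, moves in H second.  A fact about every such index therefore
-- holds for every move in either summand.
every-split-left : ∀ {ℓ a b} (P : Fin a ⊎ Fin b → Set ℓ) → (∀ j → P (splitAt a j)) → ∀ x → P (inj₁ x)
every-split-left {a = a} {b} P all x = subst P (splitAt-↑ˡ a x b) (all (x ↑ˡ b))

every-split-right : ∀ {ℓ a b} (P : Fin a ⊎ Fin b → Set ℓ) → (∀ j → P (splitAt a j)) → ∀ y → P (inj₂ y)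
every-split-right {a = a} {b} P all y = subst P (splitAt-↑ʳ a b y) (all (a ↑ʳ y))

maxFin : (k : ℕ) → (Fin k → ℕ) → ℕ
maxFin zero    f = 0
maxFin (suc k) f = f Fin.zero ⊔ maxFin k (λ x → f (Fin.suc x))

maxFin-upper : ∀ k f x → f x ≤ maxFin k f
maxFin-upper (suc k) f Fin.zero    = m≤m⊔n _ _
maxFin-upper (suc k) f (Fin.suc x) = ≤-trans (maxFin-upper k (λ y → f (Fin.suc y)) x) (m≤n⊔m _ _)

-- The cyclic turn order on suc n players (nonempty, so next computes).
module _ {n : ℕ} where

  nextⁿ : ℕ → Fin (suc n) → Fin (suc n)
  nextⁿ zero    t = t
  nextⁿ (suc r) t = nextⁿ r (next t)

  toℕ-nextⁿ : ∀ r t → toℕ (nextⁿ r t) ≡ (toℕ t + r) % suc n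
  toℕ-nextⁿ zero t = begin
    toℕ t               ≡⟨ m<n⇒m%n≡m (toℕ<n t) ⟨
    toℕ t % suc n       ≡⟨ cong (_% suc n) (+-identityʳ (toℕ t)) ⟨
    (toℕ t + 0) % suc n ∎
    where open ≡-Reasoning
  toℕ-nextⁿ (suc r) t = begin
    toℕ (nextⁿ r (next t))              ≡⟨ toℕ-nextⁿ r (next t) ⟩
    (toℕ (next t) + r) % suc n          ≡⟨ cong (λ v → (v + r) % suc n) (toℕ-fromℕ< (m%n<n (suc (toℕ t)) (suc n))) ⟩
    (suc (toℕ t) % suc n + r) % suc n   ≡⟨ [m%d+n]%d≡[m+n]%d (suc (toℕ t)) r (suc n) ⟩
    (suc (toℕ t) + r) % suc n           ≡⟨ cong (_% suc n) (+-suc (toℕ t) r) ⟨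
    (toℕ t + suc r) % suc n             ∎
    where open ≡-Reasoning

  full-round : ∀ t → nextⁿ (suc n) t ≡ t
  full-round t = toℕ-injective (begin
    toℕ (nextⁿ (suc n) t)     ≡⟨ toℕ-nextⁿ (suc n) t ⟩
    (toℕ t + suc n) % suc n   ≡⟨ [m+n]%n≡m%n (toℕ t) (suc n) ⟩
    toℕ t % suc n             ≡⟨ m<n⇒m%n≡m (toℕ<n t) ⟩
    toℕ t                     ∎)
    where open ≡-Reasoning

  nextⁿ-moves-on : ∀ r t → 0 < r → r < suc n → nextⁿ r t ≢ t
  nextⁿ-moves-on r t 0<r r<N returns = <⇒≱ r<N N≤r
    where
      x = toℕ t
      c = (x + r) / suc n
      wraps : (x + r) % suc n ≡ x
      wraps = trans (sym (toℕ-nextⁿ r t)) (cong toℕ returns)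
      r≡cN : r ≡ c * suc n
      r≡cN = +-cancelˡ-≡ x r (c * suc n) (begin
        x + r                          ≡⟨ m≡m%n+[m/n]*n (x + r) (suc n) ⟩
        (x + r) % suc n + c * suc n    ≡⟨ cong (_+ c * suc n) wraps ⟩
        x + c * suc n                  ∎)
        where open ≡-Reasoning
      N≤r : suc n ≤ r
      N≤r = subst (suc n ≤_) (sym r≡cN) (positive-multiple≥ c (suc n) (subst (0 <_) r≡cN 0<r))

module _ {N : ℕ} where

  count : Game N → Fin N → ℕ
  count (mk c _) = c

  option : (G : Game N) (t : Fin N) → Fin (count G t) → Game N
  option (mk _ o) = o

  avoid-own : ∀ {p} (G : Game N) → CanAvoid p G p → ∃ λ j → CanAvoid p (option G p j) (next p)
  avoid-own {p} (mk _ _) ca with p ≟ p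
  ... | yes _ = ca
  ... | no p≢p = ⊥-elim (p≢p refl)

  avoid-opponent : ∀ {p t} (G : Game N) → t ≢ p → CanAvoid p G t →
                   ∀ j → CanAvoid p (option G t j) (next t)
  avoid-opponent {p} {t} (mk _ _) t≢p ca with p ≟ t
  ... | yes p≡t = ⊥-elim (t≢p (sym p≡t))
  ... | no _ = ca

  avoid-stuck : ∀ {p t} (G : Game N) → t ≢ p → count G t ≡ 0 → CanAvoid p G t
  avoid-stuck {p} {t} (mk _ _) t≢p none with p ≟ t
  ... | yes p≡t = ⊥-elim (t≢p (sym p≡t))
  ... | no _ = λ j → ⊥-elim (¬Fin0 (subst Fin none j))

  sum-opponent-left : ∀ {p t} (G H : Game N) → t ≢ p → CanAvoid p (G ⊕ H) t →
                      ∀ a → CanAvoid p (option G t a ⊕ H) (next t)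
  sum-opponent-left {p} {t} G@(mk _ o) H@(mk _ q) t≢p ca =
    every-split-left (λ s → CanAvoid p ([ (λ a → o t a ⊕ H) , (λ b → G ⊕ q t b) ] s) (next t))
                     (avoid-opponent (G ⊕ H) t≢p ca)

  sum-opponent-right : ∀ {p t} (G H : Game N) → t ≢ p → CanAvoid p (G ⊕ H) t →
                       ∀ b → CanAvoid p (G ⊕ option H t b) (next t)
  sum-opponent-right {p} {t} G@(mk _ o) H@(mk _ q) t≢p ca =
    every-split-right (λ s → CanAvoid p ([ (λ a → o t a ⊕ H) , (λ b → G ⊕ q t b) ] s) (next t))
                      (avoid-opponent (G ⊕ H) t≢p ca)

  sum-own : ∀ {p} (G H : Game N) → CanAvoid p (G ⊕ H) p →
            (∃ λ a → CanAvoid p (option G p a ⊕ H) (next p)) ⊎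
            (∃ λ b → CanAvoid p (G ⊕ option H p b) (next p))
  sum-own {p} G@(mk c _) H@(mk _ _) ca with avoid-own (G ⊕ H) ca
  ... | j , safe with splitAt (c p) j
  ...   | inj₁ a = inj₁ (a , safe)
  ...   | inj₂ b = inj₂ (b , safe)

  height : Game N → ℕ
  height (mk c o) = suc (maxFin N (λ t → maxFin (c t) (λ a → height (o t a))))

  height-option : ∀ G t a → height (option G t a) < height G
  height-option (mk c o) t a =
    s≤s (≤-trans (maxFin-upper (c t) (λ a → height (o t a)) a)
                 (maxFin-upper N (λ t → maxFin (c t) (λ a → height (o t a))) t))

  single : (Fin N → Bool) → Game N → Game N
  single allowed H = mk (λ r → if allowed r then 1 else 0) (λ _ _ → H)

  single-blocked : ∀ {allowed H r} → allowed r ≡ false → count (single allowed H) r ≡ 0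
  single-blocked eq rewrite eq = refl

  single-move : ∀ {allowed H r} → allowed r ≡ true → Fin (count (single allowed H) r)
  single-move eq rewrite eq = Fin.zero

  others : Fin N → Fin N → Bool
  others x r = not (does (x ≟ r))

  others-self : ∀ x → others x x ≡ false
  others-self x rewrite dec-true (x ≟ x) refl = refl

  others-distinct : ∀ {x r} → r ≢ x → others x r ≡ true
  others-distinct {x} {r} r≢x rewrite dec-false (x ≟ r) (λ x≡r → r≢x (sym x≡r)) = refl

module Stall {n : ℕ} (p : Fin (suc n)) where

  stall : ℕ → Game (suc n)
  stall zero    = zeroG
  stall (suc M) = single (others p) (stall M)

  stall-blocks-p : ∀ M → count (stall M) p ≡ 0
  stall-blocks-p zero    = refl
  stall-blocks-p (suc M) = single-blocked {allowed = others p} {H = stall M} (others-self p)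

  -- In H ⊕ stall M, p moving loses as soon as the stall outlasts N · height H:
  -- every p-move is made in H, between two of them the opponents pass N - 1
  -- times, so p exhausts H before the stall is used up.
  p-loses : ∀ H M → height H * suc n ≤ M → ¬ CanAvoid p (H ⊕ stall M) p

  -- The same when p's turn comes r turns after the current player t:
  -- until then the opponents pass, each pass consuming one round of the stall.
  p-loses-in : ∀ H M t r → nextⁿ r t ≡ p → height H * suc n + r ≤ M →
               ¬ CanAvoid p (H ⊕ stall M) t

  p-loses H@(mk c o) M room ca with sum-own H (stall M) ca
  ... | inj₁ (a , safe) =
    p-loses-in (o p a) M (next p) n (full-round p)
               (≤-trans (blocks-room (height-option H p a) ≤-refl) room) safe
  ... | inj₂ (b , _) = ¬Fin0 (subst Fin (stall-blocks-p M) b)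

  p-loses-in H M t r p-in-r room ca with t ≟ p
  ... | yes refl = p-loses H M (≤-trans (m≤m+n _ r) room) ca
  p-loses-in H M t zero p-in-r room ca | no t≢p = t≢p p-in-r
  p-loses-in H zero t (suc r) p-in-r room ca | no t≢p =
    m+1+n≢0 (height H * suc n) (n≤0⇒n≡0 room)
  p-loses-in H (suc M) t (suc r) p-in-r room ca | no t≢p =
    p-loses-in H M (next t) r p-in-r (≤-pred (subst (_≤ suc M) (+-suc _ r) room))
               (sum-opponent-right H (stall (suc M)) t≢p ca (single-move {allowed = others p} {H = stall M} (others-distinct t≢p)))

module Distinguish {k : ℕ} (i : Fin (suc (suc (suc k)))) where

  p q : Fin (suc (suc (suc k)))
  p = next i
  q = next p

  open Stall p

  i≢p : i ≢ p
  i≢p i≡p = nextⁿ-moves-on 1 i (s≤s z≤n) (s≤s (s≤s z≤n)) (sym i≡p)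

  q≢p : q ≢ p
  q≢p = nextⁿ-moves-on 1 p (s≤s z≤n) (s≤s (s≤s z≤n))

  q≢i : q ≢ i
  q≢i = nextⁿ-moves-on 2 i (s≤s z≤n) (s≤s (s≤s (s≤s z≤n)))

  entrants : Fin (suc (suc (suc k))) → Bool
  entrants r = others i r ∧ others p r

  context : ℕ → Game (suc (suc (suc k)))
  context M = single entrants (stall M)

  zero-spares-p : ∀ M → CanAvoid p (zeroG ⊕ context M) i
  zero-spares-p M = avoid-stuck (zeroG ⊕ context M) i≢p
    (single-blocked {allowed = entrants} {H = stall M} (cong (_∧ others p i) (others-self i)))

  -- q to move: q enters the stall, after which p's turn is k + 1 turns away.
  loses-at-q : ∀ H M → height H * suc (suc (suc k)) + suc k ≤ M → ¬ CanAvoid p (H ⊕ context M) q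
  loses-at-q H M room ca = p-loses-in H M (next q) (suc k) (full-round p) room
    (sum-opponent-right H (context M) q≢p ca
      (single-move {allowed = entrants} {H = stall M} (cong₂ _∧_ (others-distinct q≢i) (others-distinct q≢p))))

  -- p to move: p cannot move in the context, so p must move in H.
  loses-at-p : ∀ H M → height H * suc (suc (suc k)) ≤ M → ¬ CanAvoid p (H ⊕ context M) p
  loses-at-p H M room ca with sum-own H (context M) ca
  ... | inj₁ (a , safe) =
    loses-at-q (option H p a) M (≤-trans (blocks-room (height-option H p a) (m<n+m (suc k) {2} (s≤s z≤n))) room) safe
  ... | inj₂ (b , _) = ¬Fin0 (subst Fin p-blocked b)
    where
      p-blocked : count (context M) p ≡ 0
      p-blocked = single-blocked {allowed = entrants} {H = stall M}
        (trans (cong (others i p ∧_) (others-self p)) (∧-zeroʳ (others i p)))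

  loses-at-i : ∀ G (a : Fin (count G i)) M → height G * suc (suc (suc k)) ≤ M → ¬ CanAvoid p (G ⊕ context M) i
  loses-at-i G a M room ca =
    loses-at-p (option G i a) M (≤-trans (*-monoˡ-≤ _ (<⇒≤ (height-option G i a))) room)
               (sum-opponent-left G (context M) i≢p ca a)

  option⇒≉0 : ∀ G (a : Fin (count G i)) → ¬ (G ≈G zeroG)
  option⇒≉0 G a G≈0 =
    loses-at-i G a M ≤-refl (Equivalence.from (G≈0 (context M) i p) (zero-spares-p M))
    where M = height G * suc (suc (suc k))

mainTheorem14 : (N : ℕ) → 2 < N → (G : Game N) → G ≈G zeroG → G ≅ zeroG
mainTheorem14 (suc (suc (suc k))) _ (mk c o) G≈0 i =
  (λ a → ⊥-elim (Distinguish.option⇒≉0 i (mk c o) a G≈0)) , λ ()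
mainTheorem14 (suc (suc zero)) (s≤s (s≤s ()))
mainTheorem14 (suc zero) (s≤s ())
mainTheorem14 zero ()
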